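{- Let $A$ carry an IF-structure in a strict symmetric monoidal $\dagger$-category, let $\mathbf{n}$ ($n\in\mathbb{N}$) be an internal integer and let $k:A\to A$ be a green-classical map. Then $\mathbf{n}\circ k=k^{n}\circ\mathbf{n}$, where $k^{n}$ denotes the $n$-fold composite of $k$ (with $k^0=\mathrm{id}_A$).
   Context: Work in a strict symmetric monoidal $\dagger$-category (unit $I$, symmetry $\sigma$; $u$ unitary means $u^\dagger u=\mathrm{id}$, $uu^\dagger=\mathrm{id}$). A $\dagger$-SCFA on $A$ is $(\mu,\eta,\delta=\mu^\dagger,\epsilon=\eta^\dagger)$ with $(\mu,\eta)$ a commutative monoid, $(\mu\otimes\mathrm{id})(\mathrm{id}\otimes\delta)=\delta\mu=(\mathrm{id}\otimes\mu)(\delta\otimes\mathrm{id})$, and $\mu\delta=\mathrm{id}_A$. An IF-structure on $A$ is a pair of $\dagger$-SCFAs, green $(\mu_g,\eta_g,\delta_g,\epsilon_g)$ and red $(\mu_r,\eta_r,\delta_r,\epsilon_r)$, with $\delta_g\mu_r=(\mu_r\otimes\mu_r)(\mathrm{id}\otimes\sigma\otimes\mathrm{id})(\delta_g\otimes\delta_g)$, $\delta_g\eta_r=\eta_r\otimes\eta_r$, $\epsilon_g\mu_r=\epsilon_g\otimes\epsilon_g$ (scalar factors built from $\epsilon_g\eta_r$ suppressed throughout), $\eta_r=(\epsilon_r\otimes\mathrm{id}_A)\delta_g\eta_g$, $\epsilon_g=\epsilon_r\mu_r(\mathrm{id}_A\otimes\eta_g)$. Internal integers: $\mathbf{0}:=\eta_r\circ\epsilon_g$,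 $\mathbf{n+1}:=\mu_r\circ(\mathbf{n}\otimes\mathrm{id}_A)\circ\delta_g$. A green-classical map is a map $k=\mu_r\circ(\psi\otimes\mathrm{id}_A)$ where $\psi:I\to A$ is green-set-like ($\delta_g\psi=\psi\otimes\psi$) and $k$ is unitary (i.e. $k$ is a red phase). -}

module Defs where

open import Level using (Level; _⊔_; suc)
open import Data.Nat using (ℕ; zero) renaming (suc to 1+)
open import Data.Product using (Σ; _×_; _,_)
open import Relation.Binary using (Rel; IsEquivalence)
open import Relation.Binary.PropositionalEquality using (_≡_; refl; sym; trans; subst₂)

-- Strictness: the object-level monoid laws hold as (propositional)
-- equalities of objects, and the morphism-level associativity / unit
-- laws hold after transporting along these equalities.  (K is
-- available, so these transports are coherent.)

idAlong : ∀ {o ℓ} {Obj : Set o} (Hom : Obj → Obj → Set ℓ)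
          (id : ∀ {X} → Hom X X) {X Y : Obj} → X ≡ Y → Hom X Y
idAlong Hom id refl = id

record StrictSMDagCat (o ℓ e : Level) : Set (suc (o ⊔ ℓ ⊔ e)) where
  infixr 9 _∘_
  infixr 10 _⊗₀_ _⊗₁_
  infix  4 _≈_
  field
    Obj  : Set o
    Hom  : Obj → Obj → Set ℓ
    _≈_  : ∀ {X Y} → Rel (Hom X Y) e
    ≈-equiv : ∀ {X Y} → IsEquivalence (_≈_ {X} {Y})

    id   : ∀ {X} → Hom X X
    _∘_  : ∀ {X Y Z} → Hom Y Z → Hom X Y → Hom X Z
    ∘-resp-≈ : ∀ {X Y Z} {f f' : Hom Y Z} {g g' : Hom X Y} →
               f ≈ f' → g ≈ g' → f ∘ g ≈ f' ∘ g'
    identityˡ : ∀ {X Y} {f : Hom X Y} → id ∘ f ≈ f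
    identityʳ : ∀ {X Y} {f : Hom X Y} → f ∘ id ≈ f
    assoc : ∀ {W X Y Z} {f : Hom Y Z} {g : Hom X Y} {h : Hom W X} →
            (f ∘ g) ∘ h ≈ f ∘ (g ∘ h)

    I     : Obj
    _⊗₀_  : Obj → Obj → Obj
    _⊗₁_  : ∀ {X Y X' Y'} → Hom X X' → Hom Y Y' → Hom (X ⊗₀ Y) (X' ⊗₀ Y')
    ⊗-resp-≈ : ∀ {X Y X' Y'} {f f' : Hom X X'} {g g' : Hom Y Y'} →
               f ≈ f' → g ≈ g' → f ⊗₁ g ≈ f' ⊗₁ g'
    ⊗-id : ∀ {X Y} → id {X} ⊗₁ id {Y} ≈ id
    ⊗-∘  : ∀ {X Y Z X' Y' Z'} {f : Hom Y Z} {g : Hom X Y}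
             {f' : Hom Y' Z'} {g' : Hom X' Y'} →
           (f ∘ g) ⊗₁ (f' ∘ g') ≈ (f ⊗₁ f') ∘ (g ⊗₁ g')

    ⊗-assoc₀  : ∀ {X Y Z} → (X ⊗₀ Y) ⊗₀ Z ≡ X ⊗₀ (Y ⊗₀ Z)
    ⊗-unitˡ₀  : ∀ {X} → I ⊗₀ X ≡ X
    ⊗-unitʳ₀  : ∀ {X} → X ⊗₀ I ≡ X
    ⊗-assoc₁  : ∀ {X Y Z X' Y' Z'} (f : Hom X X') (g : Hom Y Y') (h : Hom Z Z') →
                subst₂ Hom ⊗-assoc₀ ⊗-assoc₀ ((f ⊗₁ g) ⊗₁ h) ≈ f ⊗₁ (g ⊗₁ h)
    ⊗-unitˡ₁  : ∀ {X X'} (f : Hom X X') →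
                subst₂ Hom ⊗-unitˡ₀ ⊗-unitˡ₀ (id {I} ⊗₁ f) ≈ f
    ⊗-unitʳ₁  : ∀ {X X'} (f : Hom X X') →
                subst₂ Hom ⊗-unitʳ₀ ⊗-unitʳ₀ (f ⊗₁ id {I}) ≈ f

    σ : ∀ {X Y} → Hom (X ⊗₀ Y) (Y ⊗₀ X)
    σ-natural : ∀ {X Y X' Y'} {f : Hom X X'} {g : Hom Y Y'} →
                σ ∘ (f ⊗₁ g) ≈ (g ⊗₁ f) ∘ σ
    σ-involutive : ∀ {X Y} → σ {Y} {X} ∘ σ {X} {Y} ≈ id
    σ-hexagon : ∀ {X Y Z} →
      σ {X ⊗₀ Y} {Z}
        ≈ idAlong Hom id ⊗-assoc₀ ∘ (σ {X} {Z} ⊗₁ id {Y})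
            ∘ idAlong Hom id (sym ⊗-assoc₀)
            ∘ (id {X} ⊗₁ σ {Y} {Z}) ∘ idAlong Hom id ⊗-assoc₀

    _† : ∀ {X Y} → Hom X Y → Hom Y X
    †-resp-≈ : ∀ {X Y} {f g : Hom X Y} → f ≈ g → f † ≈ g †
    †-involutive : ∀ {X Y} {f : Hom X Y} → (f †) † ≈ f
    †-id : ∀ {X} → id {X} † ≈ id
    †-∘ : ∀ {X Y Z} {f : Hom Y Z} {g : Hom X Y} → (f ∘ g) † ≈ (g †) ∘ (f †)
    †-⊗ : ∀ {X Y X' Y'} {f : Hom X X'} {g : Hom Y Y'} → (f ⊗₁ g) † ≈ (f †) ⊗₁ (g †)
    †-σ : ∀ {X Y} → (σ {X} {Y}) † ≈ σ {Y} {X}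

  cast : ∀ {X Y} → X ≡ Y → Hom X Y
  cast = idAlong Hom id

  Unitary : ∀ {X} → Hom X X → Set e
  Unitary u = ((u †) ∘ u ≈ id) × (u ∘ (u †) ≈ id)

  _^_ : ∀ {X} → Hom X X → ℕ → Hom X X
  k ^ zero   = id
  k ^ (1+ n) = k ∘ (k ^ n)

module _ {o ℓ e} (C : StrictSMDagCat o ℓ e) where
  open StrictSMDagCat C

  record DagSCFA (A : Obj) : Set (ℓ ⊔ e) where
    field
      μ : Hom (A ⊗₀ A) A
      η : Hom I A
    δ : Hom A (A ⊗₀ A)
    δ = μ †
    ε : Hom A I
    ε = η †
    field
      μ-assoc : μ ∘ (μ ⊗₁ id) ≈ μ ∘ (id ⊗₁ μ) ∘ cast ⊗-assoc₀
      μ-unitˡ : μ ∘ (η ⊗₁ id) ≈ cast ⊗-unitˡ₀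
      μ-unitʳ : μ ∘ (id ⊗₁ η) ≈ cast ⊗-unitʳ₀
      μ-comm  : μ ∘ σ ≈ μ
      frobeniusˡ : (μ ⊗₁ id) ∘ cast (sym ⊗-assoc₀) ∘ (id ⊗₁ δ) ≈ δ ∘ μ
      frobeniusʳ : (id ⊗₁ μ) ∘ cast ⊗-assoc₀ ∘ (δ ⊗₁ id) ≈ δ ∘ μ
      special : μ ∘ δ ≈ id

  -- IF-structure (scalar factors ε_g η_r are taken to be suppressed,
  -- i.e. the equations hold on the nose)
  record IFStructure (A : Obj) : Set (ℓ ⊔ e) where
    field
      green red : DagSCFA A
    module G = DagSCFA green
    module R = DagSCFA red
    field
      bialg : G.δ ∘ R.μ ≈
        (R.μ ⊗₁ R.μ)
          ∘ cast (sym ⊗-assoc₀)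
          ∘ (id {A} ⊗₁ cast ⊗-assoc₀)
          ∘ (id {A} ⊗₁ (σ {A} {A} ⊗₁ id {A}))
          ∘ (id {A} ⊗₁ cast (sym ⊗-assoc₀))
          ∘ cast ⊗-assoc₀
          ∘ (G.δ ⊗₁ G.δ)
      copy-η : G.δ ∘ R.η ≈ (R.η ⊗₁ R.η) ∘ cast (sym ⊗-unitˡ₀)
      del-μ  : G.ε ∘ R.μ ≈ cast ⊗-unitˡ₀ ∘ (G.ε ⊗₁ G.ε)
      η-r : R.η ≈ cast ⊗-unitˡ₀ ∘ (R.ε ⊗₁ id {A}) ∘ G.δ ∘ G.η
      ε-g : G.ε ≈ R.ε ∘ R.μ ∘ (id {A} ⊗₁ G.η) ∘ cast (sym ⊗-unitʳ₀)

  module _ {A : Obj} (F : IFStructure A) where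
    open IFStructure F

    internal : ℕ → Hom A A
    internal zero   = R.η ∘ G.ε
    internal (1+ n) = R.μ ∘ (internal n ⊗₁ id) ∘ G.δ

    GreenSetLike : Hom I A → Set e
    GreenSetLike ψ = G.δ ∘ ψ ≈ (ψ ⊗₁ ψ) ∘ cast (sym ⊗-unitˡ₀)

    redMult : Hom I A → Hom A A
    redMult ψ = R.μ ∘ (ψ ⊗₁ id) ∘ cast (sym ⊗-unitˡ₀)

    GreenClassical : Hom A A → Set (ℓ ⊔ e)
    GreenClassical k =
      Σ (Hom I A) λ ψ → GreenSetLike ψ × (k ≈ redMult ψ) × Unitary k

-- The proof is
-- an induction on n that needs three properties of k:
--   (1) ε_g k = ε_g        : ε_g kills the red multiplication up to the
--                            scalar s = ε_g ψ; s is idempotent since ψ is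
--                            copyable, and unitarity of k then removes it;
--   (2) δ_g k = (k ⊗ k) δ_g : the bialgebra law plus copyability of ψ;
--   (3) μ_r (f ⊗ k) = k f μ_r for every μ_r-linear f, in particular kⁿ
--                          : associativity and commutativity of μ_r.
-- Then 0 ∘ k = η_r ε_g k = 0 by (1), and the successor case is
--   μ_r (n ⊗ id) δ_g k = μ_r (n k ⊗ k) δ_g = μ_r (kⁿ n ⊗ k) δ_g = kⁿ⁺¹ (n+1)
-- by (2), the induction hypothesis and (3).

module Submission where

open import Level using (_⊔_)
open import Data.Nat using (ℕ; zero) renaming (suc to 1+)
open import Data.Product using (Σ; _,_; proj₁; proj₂)
open import Relation.Binary.Bundles using (Setoid)
open import Relation.Binary.PropositionalEquality
  using (_≡_; refl; sym; trans; cong₂; subst₂)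
import Relation.Binary.Reasoning.Setoid as SetoidReasoning
open import Defs

module Category {o ℓ e} (C : StrictSMDagCat o ℓ e) where
  open StrictSMDagCat C

  hom-setoid : Obj → Obj → Setoid ℓ e
  hom-setoid X Y = record { Carrier = Hom X Y ; _≈_ = _≈_ ; isEquivalence = ≈-equiv }

  module _ {X Y : Obj} where
    open Setoid (hom-setoid X Y) public
      using () renaming (refl to ≈-refl; sym to ≈-sym; trans to ≈-trans)
    open SetoidReasoning (hom-setoid X Y) public

  infixr 4 _⟩∘⟨_ refl⟩∘⟨_ _⟩⊗⟨_
  infixl 5 _⟩∘⟨refl

  _⟩∘⟨_ : ∀ {X Y Z} {f f' : Hom Y Z} {g g' : Hom X Y} →
          f ≈ f' → g ≈ g' → f ∘ g ≈ f' ∘ g'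
  _⟩∘⟨_ = ∘-resp-≈

  refl⟩∘⟨_ : ∀ {X Y Z} {f : Hom Y Z} {g g' : Hom X Y} → g ≈ g' → f ∘ g ≈ f ∘ g'
  refl⟩∘⟨ p = ≈-refl ⟩∘⟨ p

  _⟩∘⟨refl : ∀ {X Y Z} {f f' : Hom Y Z} {g : Hom X Y} → f ≈ f' → f ∘ g ≈ f' ∘ g
  p ⟩∘⟨refl = p ⟩∘⟨ ≈-refl

  _⟩⊗⟨_ : ∀ {X Y X' Y'} {f f' : Hom X X'} {g g' : Hom Y Y'} →
          f ≈ f' → g ≈ g' → f ⊗₁ g ≈ f' ⊗₁ g'
  _⟩⊗⟨_ = ⊗-resp-≈

  pullˡ : ∀ {W X Y Z} {f : Hom Y Z} {g : Hom X Y} {h : Hom X Z} {k : Hom W X} →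
          f ∘ g ≈ h → f ∘ (g ∘ k) ≈ h ∘ k
  pullˡ p = ≈-trans (≈-sym assoc) (p ⟩∘⟨refl)

  extendʳ : ∀ {W X Y Y' Z} {f : Hom Y Z} {g : Hom X Y} {f' : Hom Y' Z} {g' : Hom X Y'}
            {k : Hom W X} → f ∘ g ≈ f' ∘ g' → f ∘ (g ∘ k) ≈ f' ∘ (g' ∘ k)
  extendʳ p = ≈-trans (pullˡ p) assoc

  glue : ∀ {X₀ X₁ X₂ Y₀ Y₁ Y₂} {f : Hom X₀ X₁} {f' : Hom Y₀ Y₁} {g : Hom X₁ X₂}
         {g' : Hom Y₁ Y₂} {x : Hom Y₀ X₀} {y : Hom Y₁ X₁} {z : Hom Y₂ X₂} →
         f ∘ x ≈ y ∘ f' → g ∘ y ≈ z ∘ g' → (g ∘ f) ∘ x ≈ z ∘ (g' ∘ f')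
  glue sq₁ sq₂ = ≈-trans assoc (≈-trans (refl⟩∘⟨ sq₁) (≈-trans (pullˡ sq₂) assoc))

  id-comm : ∀ {X Y} {f : Hom X Y} → f ∘ id ≈ id ∘ f
  id-comm = ≈-trans identityʳ (≈-sym identityˡ)

  ⊗-split : ∀ {X Y X' Y'} {f : Hom X X'} {g : Hom Y Y'} →
            f ⊗₁ g ≈ (f ⊗₁ id) ∘ (id ⊗₁ g)
  ⊗-split = ≈-trans (≈-sym identityʳ ⟩⊗⟨ ≈-sym identityˡ) ⊗-∘

  ⊗-split' : ∀ {X Y X' Y'} {f : Hom X X'} {g : Hom Y Y'} →
             f ⊗₁ g ≈ (id ⊗₁ g) ∘ (f ⊗₁ id)
  ⊗-split' = ≈-trans (≈-sym identityˡ ⟩⊗⟨ ≈-sym identityʳ) ⊗-∘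

  id⊗-square : ∀ {A₁ A₂ B₁ B₂ B₃ C₁} {f : Hom A₁ A₂} {x : Hom B₁ B₂} {g : Hom B₂ B₃}
               {y : Hom C₁ B₃} {g' : Hom B₁ C₁} →
               g ∘ x ≈ y ∘ g' → (id ⊗₁ g) ∘ (f ⊗₁ x) ≈ (f ⊗₁ y) ∘ (id ⊗₁ g')
  id⊗-square sq = ≈-trans (≈-sym ⊗-∘) (≈-trans (≈-sym id-comm ⟩⊗⟨ sq) ⊗-∘)

  ⊗id-square : ∀ {A₁ A₂ B₁ B₂ B₃ C₁} {h : Hom A₁ A₂} {x : Hom B₁ B₂} {g : Hom B₂ B₃}
               {y : Hom C₁ B₃} {g' : Hom B₁ C₁} →
               g ∘ x ≈ y ∘ g' → (g ⊗₁ id) ∘ (x ⊗₁ h) ≈ (y ⊗₁ h) ∘ (g' ⊗₁ id)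
  ⊗id-square sq = ≈-trans (≈-sym ⊗-∘) (≈-trans (sq ⟩⊗⟨ ≈-sym id-comm) ⊗-∘)

  cast-irrelevant : ∀ {X Y} (p q : X ≡ Y) → cast p ≈ cast q
  cast-irrelevant refl refl = ≈-refl

  cast-trans : ∀ {X Y Z} (p : Y ≡ Z) (q : X ≡ Y) → cast p ∘ cast q ≈ cast (trans q p)
  cast-trans refl refl = identityˡ

  cast-inverse : ∀ {X Y} (p : X ≡ Y) (q : Y ≡ X) → cast q ∘ cast p ≈ id
  cast-inverse p q = ≈-trans (cast-trans q p) (cast-irrelevant (trans p q) refl)

  cast-⊗ : ∀ {X Y X' Y'} (p : X ≡ X') (q : Y ≡ Y') →
           cast p ⊗₁ cast q ≈ cast (cong₂ _⊗₀_ p q)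
  cast-⊗ refl refl = ⊗-id

  cast-† : ∀ {X Y} (p : X ≡ Y) → cast p † ≈ cast (sym p)
  cast-† refl = †-id

  cast-natural : ∀ {X X' Y Y'} (p : X ≡ X') (q : Y ≡ Y') {g : Hom X Y} {f : Hom X' Y'} →
                 subst₂ Hom p q g ≈ f → cast q ∘ g ≈ f ∘ cast p
  cast-natural refl refl g≈f = ≈-trans identityˡ (≈-trans g≈f (≈-sym identityʳ))

  cast-natural⁻ : ∀ {X X' Y Y'} (p : X ≡ X') (q : Y ≡ Y') {g : Hom X Y} {f : Hom X' Y'} →
                  subst₂ Hom p q g ≈ f → g ∘ cast (sym p) ≈ cast (sym q) ∘ f
  cast-natural⁻ refl refl g≈f = ≈-trans identityʳ (≈-trans g≈f (≈-sym identityˡ))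

  assoc-natural : ∀ {X Y Z X' Y' Z'} (f : Hom X X') (g : Hom Y Y') (h : Hom Z Z') →
                  cast ⊗-assoc₀ ∘ ((f ⊗₁ g) ⊗₁ h) ≈ (f ⊗₁ (g ⊗₁ h)) ∘ cast ⊗-assoc₀
  assoc-natural f g h = cast-natural ⊗-assoc₀ ⊗-assoc₀ (⊗-assoc₁ f g h)

  assoc⁻-natural : ∀ {X Y Z X' Y' Z'} (f : Hom X X') (g : Hom Y Y') (h : Hom Z Z') →
                   cast (sym ⊗-assoc₀) ∘ (f ⊗₁ (g ⊗₁ h))
                     ≈ ((f ⊗₁ g) ⊗₁ h) ∘ cast (sym ⊗-assoc₀)
  assoc⁻-natural f g h = ≈-sym (cast-natural⁻ ⊗-assoc₀ ⊗-assoc₀ (⊗-assoc₁ f g h))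

  unitˡ-natural : ∀ {X X'} (f : Hom X X') →
                  cast ⊗-unitˡ₀ ∘ (id {I} ⊗₁ f) ≈ f ∘ cast ⊗-unitˡ₀
  unitˡ-natural f = cast-natural ⊗-unitˡ₀ ⊗-unitˡ₀ (⊗-unitˡ₁ f)

  unitˡ⁻-natural : ∀ {X X'} (f : Hom X X') →
                   (id {I} ⊗₁ f) ∘ cast (sym ⊗-unitˡ₀) ≈ cast (sym ⊗-unitˡ₀) ∘ f
  unitˡ⁻-natural f = cast-natural⁻ ⊗-unitˡ₀ ⊗-unitˡ₀ (⊗-unitˡ₁ f)

  unitʳ-natural : ∀ {X X'} (f : Hom X X') →
                  cast ⊗-unitʳ₀ ∘ (f ⊗₁ id {I}) ≈ f ∘ cast ⊗-unitʳ₀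
  unitʳ-natural f = cast-natural ⊗-unitʳ₀ ⊗-unitʳ₀ (⊗-unitʳ₁ f)

  IsCast : ∀ {X Y} → Hom X Y → Set (o ⊔ e)
  IsCast {X} {Y} f = Σ (X ≡ Y) λ p → f ≈ cast p

  cast-isCast : ∀ {X Y} (p : X ≡ Y) → IsCast (cast p)
  cast-isCast p = p , ≈-refl

  id-isCast : ∀ {X} → IsCast (id {X})
  id-isCast = refl , ≈-refl

  ∘-isCast : ∀ {X Y Z} {f : Hom Y Z} {g : Hom X Y} → IsCast f → IsCast g → IsCast (f ∘ g)
  ∘-isCast (p , f≈) (q , g≈) = trans q p , ≈-trans (f≈ ⟩∘⟨ g≈) (cast-trans p q)

  ⊗-isCast : ∀ {X Y X' Y'} {f : Hom X X'} {g : Hom Y Y'} →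
             IsCast f → IsCast g → IsCast (f ⊗₁ g)
  ⊗-isCast (p , f≈) (q , g≈) = cong₂ _⊗₀_ p q , ≈-trans (f≈ ⟩⊗⟨ g≈) (cast-⊗ p q)

  cast-coherence : ∀ {X Y} {f g : Hom X Y} → IsCast f → IsCast g → f ≈ g
  cast-coherence (p , f≈) (q , g≈) = ≈-trans f≈ (≈-trans (cast-irrelevant p q) (≈-sym g≈))

  -- Core of σ-unit, after generalising the objects so that all casts
  -- become identities: if S = a s₁ b s₂ c with casts a, b, c and S, s₁, s₂
  -- are conjugate to s by casts, then s = s ∘ cast m ∘ s.
  conjugate-hexagon :
    ∀ {P Q P' Q' U₁ U₂ V₁ V₂} (s : Hom P Q) (S : Hom P' Q') (s₁ : Hom U₁ U₂) (s₂ : Hom V₁ V₂)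
    (a : U₂ ≡ Q') (b : V₂ ≡ U₁) (c : P' ≡ V₁) (c₁ : P' ≡ P) (c₂ : Q' ≡ Q)
    (d₁ : U₂ ≡ Q) (d₁' : U₁ ≡ P) (d₂ : V₂ ≡ Q) (d₂' : V₁ ≡ P) (m : Q ≡ P) →
    S ≈ cast a ∘ s₁ ∘ cast b ∘ s₂ ∘ cast c →
    s ∘ cast c₁ ≈ cast c₂ ∘ S →
    cast d₁ ∘ s₁ ≈ s ∘ cast d₁' → cast d₂ ∘ s₂ ≈ s ∘ cast d₂' →
    s ≈ s ∘ cast m ∘ s
  conjugate-hexagon s S s₁ s₂ refl refl refl refl refl refl refl refl refl refl
                    hexagon S≈s s₁≈s s₂≈s = begin
    s
      ≈⟨ ≈-trans (≈-sym identityʳ) (≈-trans S≈s identityˡ) ⟩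
    S
      ≈⟨ hexagon ⟩
    id ∘ s₁ ∘ id ∘ s₂ ∘ id
      ≈⟨ refl⟩∘⟨ strip s₁≈s ⟩∘⟨ refl⟩∘⟨ strip s₂≈s ⟩∘⟨refl ⟩
    id ∘ s ∘ id ∘ s ∘ id
      ≈⟨ ≈-trans identityˡ (refl⟩∘⟨ refl⟩∘⟨ identityʳ) ⟩
    s ∘ id ∘ s ∎
    where
    strip : ∀ {X Y} {t u : Hom X Y} → id ∘ t ≈ u ∘ id → t ≈ u
    strip t≈u = ≈-trans (≈-sym identityˡ) (≈-trans t≈u identityʳ)

  -- In a strict symmetric monoidal category the symmetry s = σ_{I,Z} is a
  -- cast: the hexagon at X = Y = I gives s = s ∘ m ∘ s for the cast m, and
  -- since σ is involutive, m ∘ s = id, so s is the inverse cast of m.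
  σ-unit : ∀ {Z} → IsCast (σ {I} {Z})
  σ-unit {Z} = sym m , s≈cast
    where
    s : Hom (I ⊗₀ Z) (Z ⊗₀ I)
    s = σ {I} {Z}
    m : Z ⊗₀ I ≡ I ⊗₀ Z
    m = trans ⊗-unitʳ₀ (sym ⊗-unitˡ₀)
    into : (I ⊗₀ I) ⊗₀ Z ≡ I ⊗₀ Z
    into = trans ⊗-assoc₀ ⊗-unitˡ₀
    out : Z ⊗₀ (I ⊗₀ I) ≡ Z ⊗₀ I
    out = trans (sym ⊗-assoc₀) ⊗-unitʳ₀
    σ-I⊗I : s ∘ cast into ≈ cast out ∘ σ {I ⊗₀ I} {Z}
    σ-I⊗I = begin
      s ∘ cast into                        ≈⟨ refl⟩∘⟨ cast-coherence (cast-isCast into)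
                                                (⊗-isCast (cast-isCast ⊗-unitˡ₀) id-isCast) ⟩
      s ∘ (cast ⊗-unitˡ₀ ⊗₁ id)            ≈⟨ σ-natural ⟩
      (id ⊗₁ cast ⊗-unitˡ₀) ∘ σ            ≈⟨ cast-coherence
                                                (⊗-isCast id-isCast (cast-isCast ⊗-unitˡ₀))
                                                (cast-isCast out) ⟩∘⟨refl ⟩
      cast out ∘ σ                         ∎
    s-idempotent : s ≈ s ∘ cast m ∘ s
    s-idempotent =
      conjugate-hexagon s (σ {I ⊗₀ I} {Z}) (σ {I} {Z} ⊗₁ id {I}) (id {I} ⊗₁ σ {I} {Z})
        ⊗-assoc₀ (sym ⊗-assoc₀) ⊗-assoc₀ into out ⊗-unitʳ₀ ⊗-unitʳ₀ ⊗-unitˡ₀ ⊗-unitˡ₀ m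
        σ-hexagon σ-I⊗I (unitʳ-natural s) (unitˡ-natural s)
    m-inverts-s : cast m ∘ s ≈ id
    m-inverts-s = begin
      cast m ∘ s               ≈⟨ ≈-sym identityˡ ⟩
      id ∘ cast m ∘ s          ≈⟨ ≈-sym σ-involutive ⟩∘⟨refl ⟩
      (σ ∘ s) ∘ cast m ∘ s     ≈⟨ assoc ⟩
      σ ∘ s ∘ cast m ∘ s       ≈⟨ refl⟩∘⟨ ≈-sym s-idempotent ⟩
      σ ∘ s                    ≈⟨ σ-involutive ⟩
      id                       ∎
    s≈cast : s ≈ cast (sym m)
    s≈cast = begin
      s                             ≈⟨ ≈-sym identityˡ ⟩
      id ∘ s                        ≈⟨ ≈-sym (cast-inverse m (sym m)) ⟩∘⟨refl ⟩
      (cast (sym m) ∘ cast m) ∘ s   ≈⟨ assoc ⟩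
      cast (sym m) ∘ cast m ∘ s     ≈⟨ refl⟩∘⟨ m-inverts-s ⟩
      cast (sym m) ∘ id             ≈⟨ identityʳ ⟩
      cast (sym m)                  ∎

  -- The middle-four interchange (W⊗X)⊗(Y⊗Z) → (W⊗Y)⊗(X⊗Z) of the bialgebra law.
  shuffle : ∀ {W X Y Z} → Hom ((W ⊗₀ X) ⊗₀ (Y ⊗₀ Z)) ((W ⊗₀ Y) ⊗₀ (X ⊗₀ Z))
  shuffle {W} {X} {Y} {Z} =
    cast (sym ⊗-assoc₀) ∘ (id {W} ⊗₁ cast ⊗-assoc₀) ∘ (id ⊗₁ (σ {X} {Y} ⊗₁ id {Z}))
      ∘ (id ⊗₁ cast (sym ⊗-assoc₀)) ∘ cast ⊗-assoc₀

  shuffle-natural : ∀ {W X Y Z W' X' Y' Z'}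
    {a : Hom W W'} {b : Hom X X'} {c : Hom Y Y'} {d : Hom Z Z'} →
    shuffle ∘ ((a ⊗₁ b) ⊗₁ (c ⊗₁ d)) ≈ ((a ⊗₁ c) ⊗₁ (b ⊗₁ d)) ∘ shuffle
  shuffle-natural {a = a} {b} {c} {d} =
    glue (glue (glue (glue (assoc-natural a b (c ⊗₁ d))
                           (id⊗-square (assoc⁻-natural b c d)))
                     (id⊗-square (⊗id-square σ-natural)))
               (id⊗-square (assoc-natural c b d)))
         (assoc⁻-natural a c (b ⊗₁ d))

  shuffle-unit-isCast : ∀ {W Y Z} → IsCast (shuffle {W} {I} {Y} {Z})
  shuffle-unit-isCast =
    ∘-isCast (cast-isCast (sym ⊗-assoc₀)) (∘-isCast (⊗-isCast id-isCast (cast-isCast ⊗-assoc₀))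
      (∘-isCast (⊗-isCast id-isCast (⊗-isCast σ-unit id-isCast))
        (∘-isCast (⊗-isCast id-isCast (cast-isCast (sym ⊗-assoc₀))) (cast-isCast ⊗-assoc₀))))

  scalar-⊗ : ∀ {X} (s : Hom I I) (f : Hom X I) →
             cast ⊗-unitˡ₀ ∘ (s ⊗₁ f) ∘ cast (sym ⊗-unitˡ₀) ≈ s ∘ f
  scalar-⊗ s f = begin
    cast ⊗-unitˡ₀ ∘ (s ⊗₁ f) ∘ cast (sym ⊗-unitˡ₀)
      ≈⟨ refl⟩∘⟨ ⊗-split ⟩∘⟨refl ⟩
    cast ⊗-unitˡ₀ ∘ ((s ⊗₁ id) ∘ (id ⊗₁ f)) ∘ cast (sym ⊗-unitˡ₀)
      ≈⟨ cast-irrelevant ⊗-unitˡ₀ ⊗-unitʳ₀ ⟩∘⟨ assoc ⟩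
    cast ⊗-unitʳ₀ ∘ (s ⊗₁ id) ∘ (id ⊗₁ f) ∘ cast (sym ⊗-unitˡ₀)
      ≈⟨ extendʳ (unitʳ-natural s) ⟩
    s ∘ cast ⊗-unitʳ₀ ∘ (id ⊗₁ f) ∘ cast (sym ⊗-unitˡ₀)
      ≈⟨ refl⟩∘⟨ cast-irrelevant ⊗-unitʳ₀ ⊗-unitˡ₀ ⟩∘⟨refl ⟩
    s ∘ cast ⊗-unitˡ₀ ∘ (id ⊗₁ f) ∘ cast (sym ⊗-unitˡ₀)
      ≈⟨ refl⟩∘⟨ extendʳ (unitˡ-natural f) ⟩
    s ∘ f ∘ cast ⊗-unitˡ₀ ∘ cast (sym ⊗-unitˡ₀)
      ≈⟨ refl⟩∘⟨ refl⟩∘⟨ cast-inverse (sym ⊗-unitˡ₀) ⊗-unitˡ₀ ⟩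
    s ∘ f ∘ id
      ≈⟨ refl⟩∘⟨ identityʳ ⟩
    s ∘ f ∎

  -- An effect that a unitary changes only by an idempotent scalar is
  -- invariant under it: ε = s ε k† gives s ε = s s ε k† = s ε k† = ε.
  unitary-invariant : ∀ {X} {ε : Hom X I} {s : Hom I I} {k : Hom X X} →
                      Unitary k → s ∘ s ≈ s → ε ∘ k ≈ s ∘ ε → ε ∘ k ≈ ε
  unitary-invariant {ε = ε} {s} {k} (_ , k-coisometry) s-idem εk≈sε = begin
    ε ∘ k                  ≈⟨ εk≈sε ⟩
    s ∘ ε                  ≈⟨ refl⟩∘⟨ ε≈sεk† ⟩
    s ∘ s ∘ (ε ∘ k †)      ≈⟨ pullˡ s-idem ⟩
    s ∘ (ε ∘ k †)          ≈⟨ ≈-sym ε≈sεk† ⟩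
    ε                      ∎
    where
    ε≈sεk† : ε ≈ s ∘ (ε ∘ k †)
    ε≈sεk† = begin
      ε                ≈⟨ ≈-sym identityʳ ⟩
      ε ∘ id           ≈⟨ refl⟩∘⟨ ≈-sym k-coisometry ⟩
      ε ∘ k ∘ k †      ≈⟨ pullˡ εk≈sε ⟩
      (s ∘ ε) ∘ k †    ≈⟨ assoc ⟩
      s ∘ (ε ∘ k †)    ∎

module Frobenius {o ℓ e} {C : StrictSMDagCat o ℓ e} {A : StrictSMDagCat.Obj C}
                 (M : DagSCFA C A) where
  open StrictSMDagCat C
  open Category C
  open DagSCFA M

  Copyable : Hom I A → Set e
  Copyable ψ = δ ∘ ψ ≈ (ψ ⊗₁ ψ) ∘ cast (sym ⊗-unitˡ₀)

  mul : Hom I A → Hom A A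
  mul ψ = μ ∘ (ψ ⊗₁ id) ∘ cast (sym ⊗-unitˡ₀)

  Linear : Hom A A → Set e
  Linear f = μ ∘ (f ⊗₁ id) ≈ f ∘ μ

  counit-law : (ε ⊗₁ id) ∘ δ ≈ cast (sym ⊗-unitˡ₀)
  counit-law = begin
    (ε ⊗₁ id) ∘ δ             ≈⟨ (≈-refl ⟩⊗⟨ ≈-sym †-id) ⟩∘⟨refl ⟩
    (η † ⊗₁ id †) ∘ μ †       ≈⟨ ≈-sym †-⊗ ⟩∘⟨refl ⟩
    (η ⊗₁ id) † ∘ μ †         ≈⟨ ≈-sym †-∘ ⟩
    (μ ∘ (η ⊗₁ id)) †         ≈⟨ †-resp-≈ μ-unitˡ ⟩
    cast ⊗-unitˡ₀ †           ≈⟨ cast-† ⊗-unitˡ₀ ⟩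
    cast (sym ⊗-unitˡ₀)       ∎

  copyable-idempotent : ∀ {ψ} → Copyable ψ → (ε ∘ ψ) ∘ (ε ∘ ψ) ≈ ε ∘ ψ
  copyable-idempotent {ψ} copy = begin
    (ε ∘ ψ) ∘ (ε ∘ ψ)
      ≈⟨ ≈-sym (scalar-⊗ (ε ∘ ψ) (ε ∘ ψ)) ⟩
    cast ⊗-unitˡ₀ ∘ ((ε ∘ ψ) ⊗₁ (ε ∘ ψ)) ∘ cast (sym ⊗-unitˡ₀)
      ≈⟨ refl⟩∘⟨ ⊗-∘ ⟩∘⟨refl ⟩
    cast ⊗-unitˡ₀ ∘ ((ε ⊗₁ ε) ∘ (ψ ⊗₁ ψ)) ∘ cast (sym ⊗-unitˡ₀)
      ≈⟨ refl⟩∘⟨ ≈-trans assoc (refl⟩∘⟨ ≈-sym copy) ⟩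
    cast ⊗-unitˡ₀ ∘ (ε ⊗₁ ε) ∘ δ ∘ ψ
      ≈⟨ refl⟩∘⟨ ⊗-split' ⟩∘⟨refl ⟩
    cast ⊗-unitˡ₀ ∘ ((id ⊗₁ ε) ∘ (ε ⊗₁ id)) ∘ δ ∘ ψ
      ≈⟨ refl⟩∘⟨ ≈-trans assoc (refl⟩∘⟨ pullˡ counit-law) ⟩
    cast ⊗-unitˡ₀ ∘ (id ⊗₁ ε) ∘ cast (sym ⊗-unitˡ₀) ∘ ψ
      ≈⟨ refl⟩∘⟨ ≈-sym assoc ⟩
    cast ⊗-unitˡ₀ ∘ ((id ⊗₁ ε) ∘ cast (sym ⊗-unitˡ₀)) ∘ ψ
      ≈⟨ pullˡ (scalar-⊗ id ε) ⟩
    (id ∘ ε) ∘ ψ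
      ≈⟨ identityˡ ⟩∘⟨refl ⟩
    ε ∘ ψ ∎

  mul-linear : ∀ ψ → Linear (mul ψ)
  mul-linear ψ = begin
    μ ∘ ((μ ∘ (ψ ⊗₁ id) ∘ c) ⊗₁ id)
      ≈⟨ refl⟩∘⟨ ≈-trans (≈-refl ⟩⊗⟨ ≈-sym identityˡ) (≈-trans ⊗-∘
                   (refl⟩∘⟨ ≈-trans (≈-refl ⟩⊗⟨ ≈-sym identityˡ) ⊗-∘)) ⟩
    μ ∘ (μ ⊗₁ id) ∘ ((ψ ⊗₁ id) ⊗₁ id) ∘ (c ⊗₁ id)
      ≈⟨ ≈-trans (pullˡ μ-assoc) (≈-trans assoc (refl⟩∘⟨ assoc)) ⟩
    μ ∘ (id ⊗₁ μ) ∘ cast ⊗-assoc₀ ∘ ((ψ ⊗₁ id) ⊗₁ id) ∘ (c ⊗₁ id)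
      ≈⟨ refl⟩∘⟨ refl⟩∘⟨ extendʳ (assoc-natural ψ id id) ⟩
    μ ∘ (id ⊗₁ μ) ∘ (ψ ⊗₁ (id ⊗₁ id)) ∘ cast ⊗-assoc₀ ∘ (c ⊗₁ id)
      ≈⟨ refl⟩∘⟨ extendʳ (id⊗-square (≈-trans (refl⟩∘⟨ ⊗-id) id-comm)) ⟩
    μ ∘ (ψ ⊗₁ id) ∘ (id ⊗₁ μ) ∘ cast ⊗-assoc₀ ∘ (c ⊗₁ id)
      ≈⟨ refl⟩∘⟨ refl⟩∘⟨ refl⟩∘⟨ cast-coherence
           (∘-isCast (cast-isCast ⊗-assoc₀) (⊗-isCast (cast-isCast (sym ⊗-unitˡ₀)) id-isCast))
           (cast-isCast (sym ⊗-unitˡ₀)) ⟩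
    μ ∘ (ψ ⊗₁ id) ∘ (id ⊗₁ μ) ∘ cast (sym ⊗-unitˡ₀)
      ≈⟨ refl⟩∘⟨ refl⟩∘⟨ unitˡ⁻-natural μ ⟩
    μ ∘ (ψ ⊗₁ id) ∘ c ∘ μ
      ≈⟨ ≈-trans (refl⟩∘⟨ ≈-sym assoc) (≈-sym assoc) ⟩
    mul ψ ∘ μ ∎
    where
    c : Hom A (I ⊗₀ A)
    c = cast (sym ⊗-unitˡ₀)

  linear-id : Linear id
  linear-id = ≈-trans (refl⟩∘⟨ ⊗-id) id-comm

  linear-∘ : ∀ {f g} → Linear f → Linear g → Linear (f ∘ g)
  linear-∘ {f} {g} f-lin g-lin = begin
    μ ∘ ((f ∘ g) ⊗₁ id)           ≈⟨ refl⟩∘⟨ ≈-trans (≈-refl ⟩⊗⟨ ≈-sym identityˡ) ⊗-∘ ⟩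
    μ ∘ (f ⊗₁ id) ∘ (g ⊗₁ id)     ≈⟨ pullˡ f-lin ⟩
    (f ∘ μ) ∘ (g ⊗₁ id)           ≈⟨ ≈-trans assoc (refl⟩∘⟨ g-lin) ⟩
    f ∘ g ∘ μ                     ≈⟨ ≈-sym assoc ⟩
    (f ∘ g) ∘ μ                   ∎

  linear-^ : ∀ {f} → Linear f → ∀ n → Linear (f ^ n)
  linear-^ f-lin zero   = linear-id
  linear-^ f-lin (1+ n) = linear-∘ f-lin (linear-^ f-lin n)

  -- By commutativity a linear map also passes through the right argument,
  -- so μ (g ⊗ f) = f g μ for linear f and g.
  linear-⊗ : ∀ {f g} → Linear f → Linear g → μ ∘ (g ⊗₁ f) ≈ (f ∘ g) ∘ μ
  linear-⊗ {f} {g} f-lin g-lin = begin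
    μ ∘ (g ⊗₁ f)                  ≈⟨ refl⟩∘⟨ ⊗-split' ⟩
    μ ∘ (id ⊗₁ f) ∘ (g ⊗₁ id)     ≈⟨ pullˡ f-right ⟩
    (f ∘ μ) ∘ (g ⊗₁ id)           ≈⟨ ≈-trans assoc (refl⟩∘⟨ g-lin) ⟩
    f ∘ g ∘ μ                     ≈⟨ ≈-sym assoc ⟩
    (f ∘ g) ∘ μ                   ∎
    where
    f-right : μ ∘ (id ⊗₁ f) ≈ f ∘ μ
    f-right = begin
      μ ∘ (id ⊗₁ f)               ≈⟨ ≈-sym μ-comm ⟩∘⟨refl ⟩
      (μ ∘ σ) ∘ (id ⊗₁ f)         ≈⟨ ≈-trans assoc (refl⟩∘⟨ σ-natural) ⟩
      μ ∘ (f ⊗₁ id) ∘ σ           ≈⟨ pullˡ f-lin ⟩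
      (f ∘ μ) ∘ σ                 ≈⟨ ≈-trans assoc (refl⟩∘⟨ μ-comm) ⟩
      f ∘ μ                       ∎

module IF {o ℓ e} {C : StrictSMDagCat o ℓ e} {A : StrictSMDagCat.Obj C}
          (F : IFStructure C A) where
  open StrictSMDagCat C
  open Category C
  open IFStructure F
  module Green = Frobenius green
  module Red = Frobenius red

  bialgebra : G.δ ∘ R.μ ≈ (R.μ ⊗₁ R.μ) ∘ shuffle ∘ (G.δ ⊗₁ G.δ)
  bialgebra = ≈-trans bialg (refl⟩∘⟨ ≈-sym
    (≈-trans assoc (refl⟩∘⟨ ≈-trans assoc (refl⟩∘⟨ ≈-trans assoc (refl⟩∘⟨ assoc)))))

  counit-mul : ∀ ψ → G.ε ∘ Red.mul ψ ≈ (G.ε ∘ ψ) ∘ G.ε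
  counit-mul ψ = begin
    G.ε ∘ R.μ ∘ (ψ ⊗₁ id) ∘ cast (sym ⊗-unitˡ₀)
      ≈⟨ ≈-trans (pullˡ del-μ) assoc ⟩
    cast ⊗-unitˡ₀ ∘ (G.ε ⊗₁ G.ε) ∘ (ψ ⊗₁ id) ∘ cast (sym ⊗-unitˡ₀)
      ≈⟨ refl⟩∘⟨ pullˡ (≈-trans (≈-sym ⊗-∘) (≈-refl ⟩⊗⟨ identityʳ)) ⟩
    cast ⊗-unitˡ₀ ∘ ((G.ε ∘ ψ) ⊗₁ G.ε) ∘ cast (sym ⊗-unitˡ₀)
      ≈⟨ scalar-⊗ (G.ε ∘ ψ) G.ε ⟩
    (G.ε ∘ ψ) ∘ G.ε ∎

  comul-mul : ∀ {ψ} → Green.Copyable ψ → G.δ ∘ Red.mul ψ ≈ (Red.mul ψ ⊗₁ Red.mul ψ) ∘ G.δ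
  comul-mul {ψ} copy = begin
    G.δ ∘ R.μ ∘ (ψ ⊗₁ id) ∘ c
      ≈⟨ ≈-trans (pullˡ bialgebra) (≈-trans assoc (refl⟩∘⟨ assoc)) ⟩
    (R.μ ⊗₁ R.μ) ∘ shuffle ∘ (G.δ ⊗₁ G.δ) ∘ (ψ ⊗₁ id) ∘ c
      ≈⟨ refl⟩∘⟨ refl⟩∘⟨ ≈-trans (pullˡ copy-split) assoc ⟩
    (R.μ ⊗₁ R.μ) ∘ shuffle ∘ ((ψ ⊗₁ ψ) ⊗₁ (id ⊗₁ id)) ∘ (cI ⊗₁ G.δ) ∘ c
      ≈⟨ refl⟩∘⟨ extendʳ shuffle-natural ⟩
    (R.μ ⊗₁ R.μ) ∘ ((ψ ⊗₁ id) ⊗₁ (ψ ⊗₁ id)) ∘ shuffle ∘ (cI ⊗₁ G.δ) ∘ c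
      ≈⟨ refl⟩∘⟨ refl⟩∘⟨ structural-part ⟩
    (R.μ ⊗₁ R.μ) ∘ ((ψ ⊗₁ id) ⊗₁ (ψ ⊗₁ id)) ∘ (c ⊗₁ c) ∘ G.δ
      ≈⟨ ≈-trans (refl⟩∘⟨ ≈-sym assoc) (≈-sym assoc) ⟩
    ((R.μ ⊗₁ R.μ) ∘ ((ψ ⊗₁ id) ⊗₁ (ψ ⊗₁ id)) ∘ (c ⊗₁ c)) ∘ G.δ
      ≈⟨ ≈-sym (≈-trans ⊗-∘ (refl⟩∘⟨ ⊗-∘)) ⟩∘⟨refl ⟩
    (Red.mul ψ ⊗₁ Red.mul ψ) ∘ G.δ ∎
    where
    c : Hom A (I ⊗₀ A)
    c = cast (sym ⊗-unitˡ₀)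
    cI : Hom I (I ⊗₀ I)
    cI = cast (sym ⊗-unitˡ₀)
    copy-split : (G.δ ⊗₁ G.δ) ∘ (ψ ⊗₁ id)
                   ≈ ((ψ ⊗₁ ψ) ⊗₁ (id ⊗₁ id)) ∘ (cI ⊗₁ G.δ)
    copy-split = ≈-trans (≈-sym ⊗-∘) (≈-trans (copy ⟩⊗⟨ δ-id) ⊗-∘)
      where
      δ-id : G.δ ∘ id ≈ (id ⊗₁ id) ∘ G.δ
      δ-id = ≈-trans id-comm (≈-sym ⊗-id ⟩∘⟨refl)
    structural-part : shuffle ∘ (cI ⊗₁ G.δ) ∘ c ≈ (c ⊗₁ c) ∘ G.δ
    structural-part = begin
      shuffle ∘ (cI ⊗₁ G.δ) ∘ c
        ≈⟨ refl⟩∘⟨ ≈-trans (⊗-split ⟩∘⟨refl) assoc ⟩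
      shuffle ∘ (cI ⊗₁ id) ∘ (id ⊗₁ G.δ) ∘ c
        ≈⟨ refl⟩∘⟨ refl⟩∘⟨ unitˡ⁻-natural G.δ ⟩
      shuffle ∘ (cI ⊗₁ id) ∘ cast (sym ⊗-unitˡ₀) ∘ G.δ
        ≈⟨ ≈-trans (refl⟩∘⟨ ≈-sym assoc) (≈-sym assoc) ⟩
      (shuffle ∘ (cI ⊗₁ id) ∘ cast (sym ⊗-unitˡ₀)) ∘ G.δ
        ≈⟨ cast-coherence
             (∘-isCast shuffle-unit-isCast
               (∘-isCast (⊗-isCast (cast-isCast (sym ⊗-unitˡ₀)) id-isCast)
                 (cast-isCast (sym ⊗-unitˡ₀))))
             (⊗-isCast (cast-isCast (sym ⊗-unitˡ₀)) (cast-isCast (sym ⊗-unitˡ₀))) ⟩∘⟨refl ⟩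
      (c ⊗₁ c) ∘ G.δ ∎

  module Classical {k : Hom A A} (classical : GreenClassical C F k) where
    private
      ψ : Hom I A
      ψ = proj₁ classical
      copy : Green.Copyable ψ
      copy = proj₁ (proj₂ classical)
      k≈mul : k ≈ Red.mul ψ
      k≈mul = proj₁ (proj₂ (proj₂ classical))
      unitary : Unitary k
      unitary = proj₂ (proj₂ (proj₂ classical))

    counit-invariant : G.ε ∘ k ≈ G.ε
    counit-invariant =
      unitary-invariant unitary (Green.copyable-idempotent copy)
        (≈-trans (refl⟩∘⟨ k≈mul) (counit-mul ψ))

    comul-hom : G.δ ∘ k ≈ (k ⊗₁ k) ∘ G.δ
    comul-hom = begin
      G.δ ∘ k                            ≈⟨ refl⟩∘⟨ k≈mul ⟩
      G.δ ∘ Red.mul ψ                    ≈⟨ comul-mul copy ⟩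
      (Red.mul ψ ⊗₁ Red.mul ψ) ∘ G.δ     ≈⟨ ≈-sym (k≈mul ⟩⊗⟨ k≈mul) ⟩∘⟨refl ⟩
      (k ⊗₁ k) ∘ G.δ                     ∎

    linear : Red.Linear k
    linear = ≈-trans (refl⟩∘⟨ (k≈mul ⟩⊗⟨ ≈-refl))
               (≈-trans (Red.mul-linear ψ) (≈-sym k≈mul ⟩∘⟨refl))

  zero-commutes : ∀ {k} → GreenClassical C F k → internal C F 0 ∘ k ≈ id ∘ internal C F 0
  zero-commutes classical =
    ≈-trans assoc (≈-trans (refl⟩∘⟨ counit-invariant) (≈-sym identityˡ))
    where open Classical classical

  suc-commutes : ∀ {k} → GreenClassical C F k → ∀ n →
                 internal C F n ∘ k ≈ (k ^ n) ∘ internal C F n →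
                 internal C F (1+ n) ∘ k ≈ (k ^ 1+ n) ∘ internal C F (1+ n)
  suc-commutes {k} classical n hyp = begin
    (R.μ ∘ (N ⊗₁ id) ∘ G.δ) ∘ k
      ≈⟨ ≈-trans assoc (refl⟩∘⟨ assoc) ⟩
    R.μ ∘ (N ⊗₁ id) ∘ G.δ ∘ k
      ≈⟨ refl⟩∘⟨ refl⟩∘⟨ comul-hom ⟩
    R.μ ∘ (N ⊗₁ id) ∘ (k ⊗₁ k) ∘ G.δ
      ≈⟨ refl⟩∘⟨ pullˡ (≈-sym ⊗-∘) ⟩
    R.μ ∘ ((N ∘ k) ⊗₁ (id ∘ k)) ∘ G.δ
      ≈⟨ refl⟩∘⟨ (hyp ⟩⊗⟨ ≈-sym id-comm) ⟩∘⟨refl ⟩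
    R.μ ∘ (((k ^ n) ∘ N) ⊗₁ (k ∘ id)) ∘ G.δ
      ≈⟨ refl⟩∘⟨ ≈-trans (⊗-∘ ⟩∘⟨refl) assoc ⟩
    R.μ ∘ ((k ^ n) ⊗₁ k) ∘ (N ⊗₁ id) ∘ G.δ
      ≈⟨ pullˡ power-step ⟩
    ((k ^ 1+ n) ∘ R.μ) ∘ (N ⊗₁ id) ∘ G.δ
      ≈⟨ assoc ⟩
    (k ^ 1+ n) ∘ R.μ ∘ (N ⊗₁ id) ∘ G.δ ∎
    where
    open Classical classical
    N : Hom A A
    N = internal C F n
    power-step : R.μ ∘ ((k ^ n) ⊗₁ k) ≈ (k ^ 1+ n) ∘ R.μ
    power-step = Red.linear-⊗ linear (Red.linear-^ linear n)

lemma19 : ∀ {o ℓ e} (C : StrictSMDagCat o ℓ e) (A : StrictSMDagCat.Obj C)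
            (F : IFStructure C A) (n : ℕ) (k : StrictSMDagCat.Hom C A A) →
            GreenClassical C F k →
            StrictSMDagCat._≈_ C
              (StrictSMDagCat._∘_ C (internal C F n) k)
              (StrictSMDagCat._∘_ C (StrictSMDagCat._^_ C k n) (internal C F n))
lemma19 C A F zero     k classical = IF.zero-commutes F classical
lemma19 C A F (1+ n)   k classical =
  IF.suc-commutes F classical n (lemma19 C A F n k classical)
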